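{- Let $k\ge0$ be an integer, $s\in[[0,2^k-1]]$, $i\in[[0,\mathrm{last}_{k,s}]]$, $r=\mathrm{rev}_k(t_{k,s,i})$ and $l=l_{k,s,i}$. Then: (a) $X_{k,s,i,0}=\{r\}$ and for every $d\in[[1,l]]$, $\bigcup_{j=0}^{d}X_{k,s,i,j}=\{r\}\cup\mathrm{ST}_{k-1,d-1}(\mathrm{dsc}_k(r,(1)))$; (b) if $l>0$ then $X_{k,s,i}=\{r\}\cup\mathrm{ST}_{k-1,l-1}(\mathrm{dsc}_k(r,(1)))$, and if $l=0$ then $X_{k,s,i}=\{r\}$; (c) for every $d\in[[1,l]]$, $X_{k,s,i,d}=L_{k-1,d-1}(\mathrm{dsc}_k(r,(1)))$; (d) if $0\le d'<d''\le l$, $c'\in\{ -1,1\}^{d'}$, $c''\in\{ -1,1\}^{d''}$, $x'=\mathrm{dsc}_k(r,c')$, $x''=\mathrm{dsc}_k(r,c'')$ and $x',x''\in X_{k,s,i}$, then $\mathrm{rev}_k(x')<\mathrm{rev}_k(x'')$.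
   Context: $[[a,b]]=\{x\in\mathbb{Z}: a\le x\le b\}$, $n=2^k$. For $x=\sum_{i=0}^{k-1}x_i2^i\in[[0,2^k-1]]$, $\mathrm{rev}_k(x)=\sum_{i=0}^{k-1}x_i2^{k-1-i}$; for a set $S$, $\mathrm{rev}_k S=\{\mathrm{rev}_k(x):x\in S\}$. Define $t_{k,s,0}=s$, $l_{k,s,i}=\max\{l\in[[0,k]] : t_{k,s,i}\bmod 2^l=0\}$, $t_{k,s,i+1}=(t_{k,s,i}+2^{l_{k,s,i}})\bmod n$, $\mathrm{last}_{k,s}=\min\{i\ge0: t_{k,s,i}=0\}$. For $0\le i\le \mathrm{last}_{k,s}$: $Y_{k,s,i}=[[t_{k,s,i},t_{k,s,i}+2^{l_{k,s,i}}-1]]$, $X_{k,s,i}=\mathrm{rev}_kY_{k,s,i}$, and for $0\le j\le l_{k,s,i}$, $Y_{k,s,i,j}=[[t_{k,s,i}+\lfloor 2^{j-1}\rfloor,\ t_{k,s,i}+2^j-1]]$, $X_{k,s,i,j}=\mathrm{rev}_kY_{k,s,i,j}$. For an integer $x$ and $c=(c_1,\dots,c_d)\in\{ -1,1\}^d$ ($d\ge0$), $\mathrm{dsc}_k(x,c)=x+\sum_{m=1}^{d}2^{k-m}c_m$. For $d\ge0$: $L_{k,d}(x)=\{\mathrm{dsc}_k(x,c): c\in\{ -1,1\}^d\}$ and $\mathrm{ST}_{k,d}(x)=\{\mathrm{dsc}_k(x,c): c\in\{ -1,1\}^{d'},\ d'\in[[0,d]]\}$. -}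

module Defs where

open import Data.Nat using (ℕ; zero; suc; _+_; _*_; _∸_; _^_; _≤_; _<_; NonZero)
open import Data.Nat.Properties using (m^n≢0; _≟_)
open import Data.Nat.DivMod using (_/_; _%_)
open import Data.Integer as ℤ using (ℤ; +_; _◃_)
open import Data.Sign using (Sign)
open import Data.List using (map; upTo)
open import Data.Nat.ListAction using (sum)
open import Data.Vec using (Vec; []; _∷_)
open import Data.Product using (Σ; ∃; _×_)
open import Data.Sum using (_⊎_)
open import Relation.Binary.PropositionalEquality using (_≡_; _≢_)
open import Relation.Nullary using (yes; no)

_mod2^_ : ℕ → ℕ → ℕ
x mod2^ l = _%_ x (2 ^ l) {{m^n≢0 2 l}}

_div2^_ : ℕ → ℕ → ℕ
x div2^ l = _/_ x (2 ^ l) {{m^n≢0 2 l}}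

bit : ℕ → ℕ → ℕ
bit x i = (x div2^ i) mod2^ 1

rev : ℕ → ℕ → ℕ
rev k x = sum (map (λ i → bit x i * 2 ^ (k ∸ 1 ∸ i)) (upTo k))

maxL : ℕ → ℕ → ℕ
maxL zero x = zero
maxL (suc l) x with x mod2^ (suc l) ≟ 0
... | yes _ = suc l
... | no _ = maxL l x

t : ℕ → ℕ → ℕ → ℕ
t k s zero = s
t k s (suc i) = (t k s i + 2 ^ maxL k (t k s i)) mod2^ k

lv : ℕ → ℕ → ℕ → ℕ
lv k s i = maxL k (t k s i)

IsLast : ℕ → ℕ → ℕ → Set
IsLast k s m = (t k s m ≡ 0) × (∀ j → j < m → t k s j ≢ 0)

Y : ℕ → ℕ → ℕ → ℕ → Set
Y k s i y = (t k s i ≤ y) × (y ≤ t k s i + 2 ^ lv k s i ∸ 1)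

-- Y_{k,s,i,j} = [[t + ⌊2^{j-1}⌋, t + 2^j - 1]],  ⌊2^{j-1}⌋ = ⌊2^j / 2⌋
Yj : ℕ → ℕ → ℕ → ℕ → ℕ → Set
Yj k s i j y = (t k s i + (2 ^ j) div2^ 1 ≤ y) × (y ≤ t k s i + 2 ^ j ∸ 1)

X : ℕ → ℕ → ℕ → ℤ → Set
X k s i x = ∃ λ y → Y k s i y × (x ≡ + rev k y)

Xj : ℕ → ℕ → ℕ → ℕ → ℤ → Set
Xj k s i j x = ∃ λ y → Yj k s i j y × (x ≡ + rev k y)

-- dsc_k(x,c) = x + Σ_{m=1}^{d} 2^{k-m} c_m, with c_m ∈ {-1,1} encoded as Sign
dscAux : ℕ → ℕ → ∀ {d} → Vec Sign d → ℤ
dscAux k m [] = + 0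
dscAux k m (c ∷ cs) = (c ◃ 2 ^ (k ∸ m)) ℤ.+ dscAux k (suc m) cs

dsc : ℕ → ℤ → ∀ {d} → Vec Sign d → ℤ
dsc k x c = x ℤ.+ dscAux k 1 c

L : ℕ → ℕ → ℤ → ℤ → Set
L k d x y = ∃ λ (c : Vec Sign d) → y ≡ dsc k x c

ST : ℕ → ℕ → ℤ → ℤ → Set
ST k d x y = ∃ λ d' → (d' ≤ d) × (∃ λ (c : Vec Sign d') → y ≡ dsc k x c)

_≐_ : (ℤ → Set) → (ℤ → Set) → Set
P ≐ Q = ∀ x → (P x → Q x) × (Q x → P x)

｛_｝ : ℤ → ℤ → Set
｛ r ｝ x = x ≡ r

_∪_ : (ℤ → Set) → (ℤ → Set) → ℤ → Set
(P ∪ Q) x = P x ⊎ Q x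

XjUpTo : ℕ → ℕ → ℕ → ℕ → ℤ → Set
XjUpTo k s i d x = ∃ λ j → (j ≤ d) × Xj k s i j x

-- Write the block as T + u with 0 ≤ u < 2^l and 2^l ∣ T. Bit reversal then splits as
-- rev_k(T + u) = r + 2^(k-l) rev_l(u) with r = rev_k(T).  The offsets of layer d, 2^(d-1) ≤ u < 2^d,
-- reverse to the odd multiples of 2^(k-d) below 2^k, and r plus these are exactly the points
-- dsc_{k-1}(r + 2^(k-1), c) for c ∈ {-1,1}^(d-1), reading c as a binary numeral; this gives (a)-(c).
-- For (d): a descendant whose first sign is -1 lies below r, the least point of X_{k,s,i}, so a
-- length-d' descendant in X_{k,s,i} lies in layer d', and reversing back, later layers are larger.
module Submission where

open import Defs
open import Data.Nat
open import Data.Nat.Properties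
open import Data.Nat.DivMod
open import Data.Nat.Divisibility using (divides)
open import Data.Nat.ListAction using (sum)
import Data.Nat.Solver as ℕ-Solver
open import Data.List as List using (applyUpTo)
open import Data.List.Properties using (map-upTo)
open import Data.Integer as ℤ using (ℤ; _◃_)
import Data.Integer.Properties as ℤ
import Data.Integer.Solver as ℤ-Solver
open import Data.Sign using (Sign)
open import Data.Vec using (Vec; []; _∷_)
open import Data.Product
open import Data.Sum using (inj₁; inj₂)
open import Data.Empty using (⊥-elim)
open import Relation.Binary.PropositionalEquality
open import Relation.Nullary using (yes; no)
open import Function using (_∘′_)

revBits : ℕ → ℕ → ℕ
revBits zero    x = 0
revBits (suc k) x = x % 2 * 2 ^ k + revBits k (x / 2)

div2^-suc : ∀ x a → x div2^ suc a ≡ x div2^ a / 2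
div2^-suc x a = begin
    _/_ x (2 ^ suc a) {{m^n≢0 2 (suc a)}}
  ≡⟨ /-congʳ {m = x} {{m^n≢0 2 (suc a)}} {{m*n≢0 (2 ^ a) 2 {{m^n≢0 2 a}}}} (*-comm 2 (2 ^ a)) ⟩
    _/_ x (2 ^ a * 2) {{m*n≢0 (2 ^ a) 2 {{m^n≢0 2 a}}}}
  ≡⟨ m/n/o≡m/[n*o] x (2 ^ a) 2 {{m^n≢0 2 a}} {{_}} {{m*n≢0 (2 ^ a) 2 {{m^n≢0 2 a}}}} ⟨
    x div2^ a / 2 ∎
  where open ≡-Reasoning

applyUpTo-cong : ∀ {f g : ℕ → ℕ} n → (∀ i → f i ≡ g i) → applyUpTo f n ≡ applyUpTo g n
applyUpTo-cong zero    f≗g = refl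
applyUpTo-cong (suc n) f≗g = cong₂ List._∷_ (f≗g 0) (applyUpTo-cong n (λ i → f≗g (suc i)))

sum-bits≡revBits : ∀ k a x →
  sum (applyUpTo (λ i → bit x (a + i) * 2 ^ (k ∸ 1 ∸ i)) k) ≡ revBits k (x div2^ a)
sum-bits≡revBits zero    a x = refl
sum-bits≡revBits (suc k) a x = cong₂ _+_ (cong (λ b → bit x b * 2 ^ k) (+-identityʳ a)) (begin
    sum (applyUpTo (λ i → bit x (a + suc i) * 2 ^ (k ∸ suc i)) k)
  ≡⟨ cong sum (applyUpTo-cong k (λ i →
       cong₂ (λ b e → bit x b * 2 ^ e) (+-suc a i) (sym (∸-+-assoc k 1 i)))) ⟩
    sum (applyUpTo (λ i → bit x (suc a + i) * 2 ^ (k ∸ 1 ∸ i)) k)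
  ≡⟨ sum-bits≡revBits k (suc a) x ⟩
    revBits k (x div2^ suc a)
  ≡⟨ cong (revBits k) (div2^-suc x a) ⟩
    revBits k (x div2^ a / 2) ∎)
  where open ≡-Reasoning

rev≡revBits : ∀ k x → rev k x ≡ revBits k x
rev≡revBits k x = begin
  rev k x                       ≡⟨ cong sum (map-upTo _ k) ⟩
  sum (applyUpTo _ k)           ≡⟨ sum-bits≡revBits k 0 x ⟩
  revBits k (x / 1)             ≡⟨ cong (revBits k) (n/1≡n x) ⟩
  revBits k x                   ∎
  where open ≡-Reasoning

revBits-< : ∀ k x → revBits k x < 2 ^ k
revBits-< zero    x = s≤s z≤n
revBits-< (suc k) x = begin-strict
    x % 2 * 2 ^ k + revBits k (x / 2)
  <⟨ +-mono-≤-< (*-monoˡ-≤ (2 ^ k) (s≤s⁻¹ (m%n<n x 2))) (revBits-< k (x / 2)) ⟩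
    1 * 2 ^ k + 2 ^ k
  ≡⟨ cong (_+ 2 ^ k) (*-identityˡ (2 ^ k)) ⟩
    2 ^ k + 2 ^ k
  ≡⟨ cong (2 ^ k +_) (+-identityʳ (2 ^ k)) ⟨
    2 ^ suc k ∎
  where open ≤-Reasoning

revBits-zero : ∀ k → revBits k 0 ≡ 0
revBits-zero zero    = refl
revBits-zero (suc k) = revBits-zero k

revBits-split : ∀ l j u q → u < 2 ^ l →
  revBits (l + j) (u + 2 ^ l * q) ≡ 2 ^ j * revBits l u + revBits j q
revBits-split zero    j zero q _ = begin
  revBits j (q + 0)             ≡⟨ cong (revBits j) (+-identityʳ q) ⟩
  revBits j q                   ≡⟨ cong (_+ revBits j q) (*-zeroʳ (2 ^ j)) ⟨
  2 ^ j * 0 + revBits j q       ∎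
  where open ≡-Reasoning
revBits-split zero    j (suc u) q (s≤s ())
revBits-split (suc l) j u q u<2^l = begin
    (u + 2 ^ suc l * q) % 2 * 2 ^ (l + j) + revBits (l + j) ((u + 2 ^ suc l * q) / 2)
  ≡⟨ cong (λ v → v % 2 * 2 ^ (l + j) + revBits (l + j) (v / 2)) 2^suc[l]q≡2^lq*2 ⟩
    (u + w * 2) % 2 * 2 ^ (l + j) + revBits (l + j) ((u + w * 2) / 2)
  ≡⟨ cong₂ (λ b v → b * 2 ^ (l + j) + revBits (l + j) v)
       ([m+kn]%n≡m%n u w 2) (trans (+-distrib-/-∣ʳ u (divides w refl)) (cong (u / 2 +_) (m*n/n≡m w 2))) ⟩
    u % 2 * 2 ^ (l + j) + revBits (l + j) (u / 2 + 2 ^ l * q)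
  ≡⟨ cong₂ (λ p v → u % 2 * p + v) (^-distribˡ-+-* 2 l j)
       (revBits-split l j (u / 2) q (m<n*o⇒m/o<n (subst (u <_) (*-comm 2 (2 ^ l)) u<2^l))) ⟩
    u % 2 * (2 ^ l * 2 ^ j) + (2 ^ j * revBits l (u / 2) + revBits j q)
  ≡⟨ solve 5 (λ b P J R Q → b :* (P :* J) :+ (J :* R :+ Q) := J :* (b :* P :+ R) :+ Q)
       refl (u % 2) (2 ^ l) (2 ^ j) (revBits l (u / 2)) (revBits j q) ⟩
    2 ^ j * (u % 2 * 2 ^ l + revBits l (u / 2)) + revBits j q ∎
  where
  open ≡-Reasoning
  open ℕ-Solver.+-*-Solver
  w = 2 ^ l * q
  2^suc[l]q≡2^lq*2 : u + 2 ^ suc l * q ≡ u + w * 2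
  2^suc[l]q≡2^lq*2 = cong (u +_) (trans (*-assoc 2 (2 ^ l) q) (*-comm 2 w))

revBits-involutive : ∀ k u → u < 2 ^ k → revBits k (revBits k u) ≡ u
revBits-involutive zero    zero    _         = refl
revBits-involutive zero    (suc u) (s≤s ())
revBits-involutive (suc k) u u<2^k = begin
    revBits (suc k) (u % 2 * 2 ^ k + R)
  ≡⟨ cong₂ revBits (+-comm 1 k) (trans (+-comm _ R) (cong (R +_) (*-comm (u % 2) (2 ^ k)))) ⟩
    revBits (k + 1) (R + 2 ^ k * (u % 2))
  ≡⟨ revBits-split k 1 R (u % 2) (revBits-< k (u / 2)) ⟩
    2 * revBits k R + (u % 2 % 2 * 1 + 0)
  ≡⟨ cong₂ (λ a b → 2 * a + (b * 1 + 0))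
       (revBits-involutive k (u / 2) (m<n*o⇒m/o<n (subst (u <_) (*-comm 2 (2 ^ k)) u<2^k)))
       (m%n%n≡m%n u 2) ⟩
    2 * (u / 2) + (u % 2 * 1 + 0)
  ≡⟨ solve 2 (λ a b → con 2 :* a :+ (b :* con 1 :+ con 0) := b :+ a :* con 2) refl (u / 2) (u % 2) ⟩
    u % 2 + u / 2 * 2
  ≡⟨ m≡m%n+[m/n]*n u 2 ⟨
    u ∎
  where
  open ≡-Reasoning
  open ℕ-Solver.+-*-Solver
  R = revBits k (u / 2)

revBits-2^+ : ∀ l d u → suc d ≤ l → u < 2 ^ d →
  revBits l (2 ^ d + u) ≡ 2 ^ (l ∸ suc d) * suc (2 * revBits d u)
revBits-2^+ l d u d<l u<2^d = begin
    revBits l w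
  ≡⟨ cong₂ revBits (m+[n∸m]≡n d<l) (trans (cong (w +_) (*-zeroʳ (2 ^ suc d))) (+-identityʳ w)) ⟨
    revBits (suc d + e) (w + 2 ^ suc d * 0)
  ≡⟨ revBits-split (suc d) e w 0 w<2^suc[d] ⟩
    2 ^ e * revBits (suc d) w + revBits e 0
  ≡⟨ cong₂ (λ a b → 2 ^ e * a + b) revBits-w (revBits-zero e) ⟩
    2 ^ e * suc (2 * revBits d u) + 0
  ≡⟨ +-identityʳ _ ⟩
    2 ^ e * suc (2 * revBits d u) ∎
  where
  open ≡-Reasoning
  w = 2 ^ d + u
  e = l ∸ suc d
  w<2^suc[d] : w < 2 ^ suc d
  w<2^suc[d] = subst (w <_) (cong (2 ^ d +_) (sym (+-identityʳ (2 ^ d)))) (+-monoʳ-< (2 ^ d) u<2^d)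
  revBits-w : revBits (suc d) w ≡ suc (2 * revBits d u)
  revBits-w = begin
    revBits (suc d) w               ≡⟨ cong₂ revBits (+-comm d 1)
                                         (trans (cong (u +_) (*-identityʳ (2 ^ d))) (+-comm u (2 ^ d))) ⟨
    revBits (d + 1) (u + 2 ^ d * 1) ≡⟨ revBits-split d 1 u 1 u<2^d ⟩
    2 * revBits d u + 1             ≡⟨ +-comm _ 1 ⟩
    suc (2 * revBits d u)           ∎

rev-involutive : ∀ k y → y < 2 ^ k → rev k (rev k y) ≡ y
rev-involutive k y y<2^k = begin
  rev k (rev k y)           ≡⟨ rev≡revBits k (rev k y) ⟩
  revBits k (rev k y)       ≡⟨ cong (revBits k) (rev≡revBits k y) ⟩
  revBits k (revBits k y)   ≡⟨ revBits-involutive k y y<2^k ⟩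
  y                         ∎
  where open ≡-Reasoning

2^suc≡2^+2^ : ∀ d → 2 ^ suc d ≡ 2 ^ d + 2 ^ d
2^suc≡2^+2^ d = cong (2 ^ d +_) (+-identityʳ (2 ^ d))

2^suc/2≡2^ : ∀ d → (2 ^ suc d) div2^ 1 ≡ 2 ^ d
2^suc/2≡2^ d = trans (cong (_/ 2) (*-comm 2 (2 ^ d))) (m*n/n≡m (2 ^ d) 2)

2^[k∸l]*2^[l∸m]≡2^[k∸m] : ∀ k l m → m ≤ l → l ≤ k → 2 ^ (k ∸ l) * 2 ^ (l ∸ m) ≡ 2 ^ (k ∸ m)
2^[k∸l]*2^[l∸m]≡2^[k∸m] k l m m≤l l≤k = begin
  2 ^ (k ∸ l) * 2 ^ (l ∸ m) ≡⟨ ^-distribˡ-+-* 2 (k ∸ l) (l ∸ m) ⟨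
  2 ^ (k ∸ l + (l ∸ m))     ≡⟨ cong (2 ^_) (+-∸-assoc (k ∸ l) m≤l) ⟨
  2 ^ (k ∸ l + l ∸ m)       ≡⟨ cong (λ n → 2 ^ (n ∸ m)) (m∸n+n≡m l≤k) ⟩
  2 ^ (k ∸ m)               ∎
  where open ≡-Reasoning

≤∸1⇒< : ∀ {y n} → y ≤ n ∸ 1 → 0 < n → y < n
≤∸1⇒< {n = suc n} y≤n _ = s≤s y≤n

<⇒≤∸1 : ∀ {y n} → y < n → y ≤ n ∸ 1
<⇒≤∸1 (s≤s y≤n) = y≤n

interval⇒offset : ∀ T {a b y} → T + a ≤ y → y ≤ T + b ∸ 1 → 0 < b →
  ∃ λ u → (a ≤ u × u < b) × y ≡ T + u
interval⇒offset T {a} {b} {y} T+a≤y y≤T+b∸1 0<b = y ∸ T , (a≤u , u<b) , sym y≡T+u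
  where
  y≡T+u : T + (y ∸ T) ≡ y
  y≡T+u = m+[n∸m]≡n (m+n≤o⇒m≤o T T+a≤y)
  a≤u : a ≤ y ∸ T
  a≤u = +-cancelˡ-≤ T a (y ∸ T) (subst (T + a ≤_) (sym y≡T+u) T+a≤y)
  u<b : y ∸ T < b
  u<b = +-cancelˡ-< T (y ∸ T) b
          (subst (_< T + b) (sym y≡T+u) (≤∸1⇒< y≤T+b∸1 (≤-trans 0<b (m≤n+m b T))))

offset⇒interval : ∀ T {a b u} → a ≤ u → u < b → T + a ≤ T + u × T + u ≤ T + b ∸ 1
offset⇒interval T a≤u u<b = +-monoʳ-≤ T a≤u , <⇒≤∸1 (+-monoʳ-< T u<b)

InLayer : ℕ → ℕ → Set
InLayer d u = (2 ^ d) div2^ 1 ≤ u × u < 2 ^ d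

inLayer-zero : ∀ {u} → InLayer 0 u → u ≡ 0
inLayer-zero (_ , s≤s z≤n) = refl

inLayer-suc⇒ : ∀ d {u} → InLayer (suc d) u → ∃ λ v → v < 2 ^ d × u ≡ 2 ^ d + v
inLayer-suc⇒ d {u} (lo , hi) = u ∸ 2 ^ d , v<2^d , sym (m+[n∸m]≡n 2^d≤u)
  where
  2^d≤u : 2 ^ d ≤ u
  2^d≤u = subst (_≤ u) (2^suc/2≡2^ d) lo
  v<2^d : u ∸ 2 ^ d < 2 ^ d
  v<2^d = m<n+o⇒m∸n<o u (2 ^ d) {{m^n≢0 2 d}} (subst (u <_) (2^suc≡2^+2^ d) hi)

inLayer-suc⇐ : ∀ d {v} → v < 2 ^ d → InLayer (suc d) (2 ^ d + v)
inLayer-suc⇐ d {v} v<2^d =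
  subst (_≤ 2 ^ d + v) (sym (2^suc/2≡2^ d)) (m≤m+n (2 ^ d) v) ,
  subst (2 ^ d + v <_) (sym (2^suc≡2^+2^ d)) (+-monoʳ-< (2 ^ d) v<2^d)

layerOf : ∀ m u → u < 2 ^ m → ∃ λ d → d ≤ m × InLayer d u
layerOf zero    u     u<1 = 0 , z≤n , z≤n , u<1
layerOf (suc m) u u<2^suc[m] with u <? 2 ^ m
... | yes u<2^m = let d , d≤m , u∈d = layerOf m u u<2^m in d , m≤n⇒m≤1+n d≤m , u∈d
... | no  u≮2^m = suc m , ≤-refl , subst (_≤ u) (sym (2^suc/2≡2^ m)) (≮⇒≥ u≮2^m) , u<2^suc[m]

inLayer-< : ∀ {d' d'' u' u''} → d' < d'' → InLayer d' u' → InLayer d'' u'' → u' < u''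
inLayer-< {d'} {suc d} {u'} {u''} (s≤s d'≤d) (_ , u'<2^d') (lo , _) = begin-strict
  u'                 <⟨ u'<2^d' ⟩
  2 ^ d'             ≤⟨ ^-monoʳ-≤ 2 d'≤d ⟩
  2 ^ d              ≡⟨ 2^suc/2≡2^ d ⟨
  (2 ^ suc d) div2^ 1 ≤⟨ lo ⟩
  u''                ∎
  where open ≤-Reasoning

fromSigns : ∀ {n} → Vec Sign n → ℕ
fromSigns []                     = 0
fromSigns {suc n} (Sign.+ ∷ c) = 2 ^ n + fromSigns c
fromSigns {suc n} (Sign.- ∷ c) = fromSigns c

fromSigns-< : ∀ {n} (c : Vec Sign n) → fromSigns c < 2 ^ n
fromSigns-< []                     = s≤s z≤n
fromSigns-< {suc n} (Sign.+ ∷ c) =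
  subst (2 ^ n + fromSigns c <_) (sym (2^suc≡2^+2^ n)) (+-monoʳ-< (2 ^ n) (fromSigns-< c))
fromSigns-< {suc n} (Sign.- ∷ c) = <-≤-trans (fromSigns-< c) (m≤m+n (2 ^ n) (2 ^ n + 0))

fromSigns-surjective : ∀ n B → B < 2 ^ n → ∃ λ (c : Vec Sign n) → fromSigns c ≡ B
fromSigns-surjective zero    zero    _        = [] , refl
fromSigns-surjective zero    (suc B) (s≤s ())
fromSigns-surjective (suc n) B B<2^suc[n] with B <? 2 ^ n
... | yes B<2^n = let c , c↦B = fromSigns-surjective n B B<2^n in Sign.- ∷ c , c↦B
... | no  B≮2^n =
  let c , c↦B∸2^n = fromSigns-surjective n (B ∸ 2 ^ n)
                      (m<n+o⇒m∸n<o B (2 ^ n) {{m^n≢0 2 n}} (subst (B <_) (2^suc≡2^+2^ n) B<2^suc[n]))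
  in Sign.+ ∷ c , trans (cong (2 ^ n +_) c↦B∸2^n) (m+[n∸m]≡n (≮⇒≥ B≮2^n))

dscAux-pred : ∀ k m {n} (c : Vec Sign n) → dscAux k (suc m) c ≡ dscAux (k ∸ 1) m c
dscAux-pred k m []      = refl
dscAux-pred k m (s ∷ c) =
  cong₂ ℤ._+_ (cong (λ e → s ◃ 2 ^ e) (sym (∸-+-assoc k 1 m))) (dscAux-pred k (suc m) c)

dsc-∷ : ∀ k x s {n} (c : Vec Sign n) → dsc k x (s ∷ c) ≡ dsc (k ∸ 1) (dsc k x (s ∷ [])) c
dsc-∷ k x s c = begin
    x ℤ.+ (S ℤ.+ dscAux k 2 c)        ≡⟨ cong (λ a → x ℤ.+ (S ℤ.+ a)) (dscAux-pred k 1 c) ⟩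
    x ℤ.+ (S ℤ.+ dscAux (k ∸ 1) 1 c)  ≡⟨ ℤ.+-assoc x S _ ⟨
    x ℤ.+ S ℤ.+ dscAux (k ∸ 1) 1 c    ≡⟨ cong (λ a → x ℤ.+ a ℤ.+ dscAux (k ∸ 1) 1 c) (ℤ.+-identityʳ S) ⟨
    dsc (k ∸ 1) (dsc k x (s ∷ [])) c  ∎
  where
  open ≡-Reasoning
  S = s ◃ 2 ^ (k ∸ 1)

+2^suc≡+2^++2^ : ∀ K → ℤ.+ (2 ^ suc K) ≡ ℤ.+ (2 ^ K) ℤ.+ ℤ.+ (2 ^ K)
+2^suc≡+2^++2^ K = trans (cong ℤ.+_ (2^suc≡2^+2^ K)) (ℤ.pos-+ (2 ^ K) (2 ^ K))

-- Induction on the leading sign: a − cancels half of 2^(K+1), a + adds the top binary digit.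
2^+dscAux≡odd : ∀ K {n} (c : Vec Sign n) → n ≤ K →
  ℤ.+ (2 ^ K) ℤ.+ dscAux K 1 c ≡ ℤ.+ (2 ^ (K ∸ n) * suc (2 * fromSigns c))
2^+dscAux≡odd K       []      _         =
  trans (ℤ.+-identityʳ _) (cong ℤ.+_ (sym (*-identityʳ (2 ^ K))))
2^+dscAux≡odd (suc K) {suc n} (s ∷ c) (s≤s n≤K) = step s
  where
  P = 2 ^ (K ∸ n)
  D = dscAux K 1 c
  IH : ℤ.+ (2 ^ K) ℤ.+ D ≡ ℤ.+ (P * suc (2 * fromSigns c))
  IH = 2^+dscAux≡odd K c n≤K
  D≡ : dscAux (suc K) 2 c ≡ D
  D≡ = dscAux-pred (suc K) 1 c
  step : ∀ s → ℤ.+ (2 ^ suc K) ℤ.+ ((s ◃ 2 ^ K) ℤ.+ dscAux (suc K) 2 c)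
                 ≡ ℤ.+ (P * suc (2 * fromSigns (s ∷ c)))
  step Sign.+ = begin
      ℤ.+ (2 ^ suc K) ℤ.+ ((Sign.+ ◃ 2 ^ K) ℤ.+ dscAux (suc K) 2 c)
    ≡⟨ cong₂ (λ a b → ℤ.+ (2 ^ suc K) ℤ.+ (a ℤ.+ b)) (ℤ.+◃n≡+n (2 ^ K)) D≡ ⟩
      ℤ.+ (2 ^ suc K) ℤ.+ (ℤ.+ (2 ^ K) ℤ.+ D)
    ≡⟨ cong (λ a → ℤ.+ (2 ^ suc K) ℤ.+ a) IH ⟩
      ℤ.+ (2 ^ suc K) ℤ.+ ℤ.+ (P * suc (2 * fromSigns c))
    ≡⟨ ℤ.pos-+ (2 ^ suc K) _ ⟨
      ℤ.+ (2 * 2 ^ K + P * suc (2 * fromSigns c))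
    ≡⟨ cong (λ a → ℤ.+ (2 * a + P * suc (2 * fromSigns c))) P*2^n≡2^K ⟨
      ℤ.+ (2 * (P * 2 ^ n) + P * suc (2 * fromSigns c))
    ≡⟨ cong ℤ.+_ (solve 3 (λ p N e → con 2 :* (p :* N) :+ p :* (con 1 :+ con 2 :* e)
                                   := p :* (con 1 :+ con 2 :* (N :+ e))) refl P (2 ^ n) (fromSigns c)) ⟩
      ℤ.+ (P * suc (2 * (2 ^ n + fromSigns c))) ∎
    where
    open ≡-Reasoning
    open ℕ-Solver.+-*-Solver
    P*2^n≡2^K : P * 2 ^ n ≡ 2 ^ K
    P*2^n≡2^K = trans (sym (^-distribˡ-+-* 2 (K ∸ n) n)) (cong (2 ^_) (m∸n+n≡m n≤K))
  step Sign.- = begin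
      ℤ.+ (2 ^ suc K) ℤ.+ ((Sign.- ◃ 2 ^ K) ℤ.+ dscAux (suc K) 2 c)
    ≡⟨ cong (λ b → ℤ.+ (2 ^ suc K) ℤ.+ ((Sign.- ◃ 2 ^ K) ℤ.+ b)) D≡ ⟩
      ℤ.+ (2 ^ suc K) ℤ.+ ((Sign.- ◃ 2 ^ K) ℤ.+ D)
    ≡⟨ cong₂ (λ a b → a ℤ.+ (b ℤ.+ D)) (+2^suc≡+2^++2^ K) (ℤ.-◃n≡-n (2 ^ K)) ⟩
      ℤ.+ (2 ^ K) ℤ.+ ℤ.+ (2 ^ K) ℤ.+ (ℤ.- ℤ.+ (2 ^ K) ℤ.+ D)
    ≡⟨ solve 2 (λ a d → a :+ a :+ (:- a :+ d) := a :+ d) refl (ℤ.+ (2 ^ K)) D ⟩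
      ℤ.+ (2 ^ K) ℤ.+ D
    ≡⟨ IH ⟩
      ℤ.+ (P * suc (2 * fromSigns c)) ∎
    where
    open ≡-Reasoning
    open ℤ-Solver.+-*-Solver

odd*2^-< : ∀ K n B → n ≤ K → B < 2 ^ n → 2 ^ (K ∸ n) * suc (2 * B) < 2 ^ suc K
odd*2^-< K n B n≤K B<2^n = begin-strict
  2 ^ (K ∸ n) * suc (2 * B)   <⟨ *-monoʳ-< (2 ^ (K ∸ n)) {{m^n≢0 2 (K ∸ n)}} odd<2^suc[n] ⟩
  2 ^ (K ∸ n) * 2 ^ suc n     ≡⟨ ^-distribˡ-+-* 2 (K ∸ n) (suc n) ⟨
  2 ^ (K ∸ n + suc n)         ≡⟨ cong (2 ^_) (trans (+-suc (K ∸ n) n) (cong suc (m∸n+n≡m n≤K))) ⟩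
  2 ^ suc K                   ∎
  where
  open ≤-Reasoning
  odd<2^suc[n] : suc (2 * B) < 2 ^ suc n
  odd<2^suc[n] = subst (_≤ 2 ^ suc n) (*-suc 2 B) (*-monoʳ-≤ 2 B<2^n)

dsc-+∷ : ∀ k x {n} (c : Vec Sign n) → suc n ≤ k →
  dsc k x (Sign.+ ∷ c) ≡ x ℤ.+ ℤ.+ (2 ^ (k ∸ suc n) * suc (2 * fromSigns c))
dsc-+∷ (suc K) x {n} c (s≤s n≤K) = cong (λ a → x ℤ.+ a) (begin
  (Sign.+ ◃ 2 ^ K) ℤ.+ dscAux (suc K) 2 c
    ≡⟨ cong₂ ℤ._+_ (ℤ.+◃n≡+n (2 ^ K)) (dscAux-pred (suc K) 1 c) ⟩
  ℤ.+ (2 ^ K) ℤ.+ dscAux K 1 c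
    ≡⟨ 2^+dscAux≡odd K c n≤K ⟩
  ℤ.+ (2 ^ (K ∸ n) * suc (2 * fromSigns c)) ∎)
  where open ≡-Reasoning

dsc-−∷ : ∀ k x {n} (c : Vec Sign n) → suc n ≤ k →
  dsc k x (Sign.- ∷ c) ℤ.+ ℤ.+ (2 ^ k) ≡ x ℤ.+ ℤ.+ (2 ^ (k ∸ suc n) * suc (2 * fromSigns c))
dsc-−∷ (suc K) x {n} c (s≤s n≤K) = begin
    x ℤ.+ ((Sign.- ◃ 2 ^ K) ℤ.+ dscAux (suc K) 2 c) ℤ.+ ℤ.+ (2 ^ suc K)
  ≡⟨ cong₂ (λ a b → x ℤ.+ (a ℤ.+ b) ℤ.+ ℤ.+ (2 ^ suc K))
       (ℤ.-◃n≡-n (2 ^ K)) (dscAux-pred (suc K) 1 c) ⟩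
    x ℤ.+ (ℤ.- A ℤ.+ D) ℤ.+ ℤ.+ (2 ^ suc K)
  ≡⟨ cong (λ a → x ℤ.+ (ℤ.- A ℤ.+ D) ℤ.+ a) (+2^suc≡+2^++2^ K) ⟩
    x ℤ.+ (ℤ.- A ℤ.+ D) ℤ.+ (A ℤ.+ A)
  ≡⟨ solve 3 (λ x a d → x :+ (:- a :+ d) :+ (a :+ a) := x :+ (a :+ d)) refl x A D ⟩
    x ℤ.+ (A ℤ.+ D)
  ≡⟨ cong (λ a → x ℤ.+ a) (2^+dscAux≡odd K c n≤K) ⟩
    x ℤ.+ ℤ.+ (2 ^ (K ∸ n) * suc (2 * fromSigns c)) ∎
  where
  open ≡-Reasoning
  open ℤ-Solver.+-*-Solver
  A = ℤ.+ (2 ^ K)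
  D = dscAux K 1 c

-- The signs after a leading − move dsc by less than 2^(k-1) in total.
dsc-−∷-< : ∀ k r v {n} (c : Vec Sign n) → suc n ≤ k → dsc k (ℤ.+ r) (Sign.- ∷ c) ≡ ℤ.+ v → v < r
dsc-−∷-< (suc K) r v {n} c n<k dsc≡v = +-cancelʳ-< (2 ^ suc K) v r (begin-strict
    v + 2 ^ suc K   ≡⟨ ℤ.+-injective v+2^suc[K]≡r+M ⟩
    r + M           <⟨ +-monoʳ-< r (odd*2^-< K n (fromSigns c) (s≤s⁻¹ n<k) (fromSigns-< c)) ⟩
    r + 2 ^ suc K   ∎)
  where
  open ≤-Reasoning
  M = 2 ^ (K ∸ n) * suc (2 * fromSigns c)
  v+2^suc[K]≡r+M : ℤ.+ (v + 2 ^ suc K) ≡ ℤ.+ (r + M)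
  v+2^suc[K]≡r+M = trans (ℤ.pos-+ v (2 ^ suc K)) (trans
    (cong (λ a → a ℤ.+ ℤ.+ (2 ^ suc K)) (sym dsc≡v))
    (trans (dsc-−∷ (suc K) (ℤ.+ r) c n<k) (sym (ℤ.pos-+ r M))))

≐-trans : ∀ {P Q R : ℤ → Set} → P ≐ Q → Q ≐ R → P ≐ R
≐-trans P≐Q Q≐R x = proj₁ (Q≐R x) ∘′ proj₁ (P≐Q x) , proj₂ (P≐Q x) ∘′ proj₂ (Q≐R x)

-- { x + (2B+1) 2^(k-1-d) : B < 2^d }: both L_{k-1,d}(dsc_k(x,(1))) and, for x = r, the reversed layer d+1.
OddShift : ℕ → ℤ → ℕ → ℤ → Set
OddShift k x d y = ∃ λ B → B < 2 ^ d × y ≡ x ℤ.+ ℤ.+ (2 ^ (k ∸ suc d) * suc (2 * B))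

OddShift≐L : ∀ k x d → suc d ≤ k → OddShift k x d ≐ L (k ∸ 1) d (dsc k x (Sign.+ ∷ []))
OddShift≐L k x d d<k y = to , from
  where
  open ≡-Reasoning
  P = 2 ^ (k ∸ suc d)
  to : OddShift k x d y → L (k ∸ 1) d (dsc k x (Sign.+ ∷ [])) y
  to (B , B<2^d , y≡) =
    let c , c↦B = fromSigns-surjective d B B<2^d
    in c , (begin
      y                                            ≡⟨ y≡ ⟩
      x ℤ.+ ℤ.+ (P * suc (2 * B))                  ≡⟨ cong (λ b → x ℤ.+ ℤ.+ (P * suc (2 * b))) c↦B ⟨
      x ℤ.+ ℤ.+ (P * suc (2 * fromSigns c))        ≡⟨ dsc-+∷ k x c d<k ⟨
      dsc k x (Sign.+ ∷ c)                         ≡⟨ dsc-∷ k x Sign.+ c ⟩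
      dsc (k ∸ 1) (dsc k x (Sign.+ ∷ [])) c        ∎)
  from : L (k ∸ 1) d (dsc k x (Sign.+ ∷ [])) y → OddShift k x d y
  from (c , y≡) = fromSigns c , fromSigns-< c , (begin
      y                                            ≡⟨ y≡ ⟩
      dsc (k ∸ 1) (dsc k x (Sign.+ ∷ [])) c        ≡⟨ dsc-∷ k x Sign.+ c ⟨
      dsc k x (Sign.+ ∷ c)                         ≡⟨ dsc-+∷ k x c d<k ⟩
      x ℤ.+ ℤ.+ (P * suc (2 * fromSigns c))        ∎)

-- RevBlock, RevLayer j and RevLayersUpTo d are X_{k,s,i}, X_{k,s,i,j} and ⋃_{j≤d} X_{k,s,i,j},
-- with t_{k,s,i} and l_{k,s,i} abstracted to T and l.
module AlignedBlock (k T l : ℕ) (l≤k : l ≤ k) (2^l∣T : T mod2^ l ≡ 0) (T<2^k : T < 2 ^ k) where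

  r : ℕ
  r = rev k T

  z : ℤ
  z = dsc k (ℤ.+ r) (Sign.+ ∷ [])

  RevBlock : ℤ → Set
  RevBlock x = ∃ λ y → (T ≤ y × y ≤ T + 2 ^ l ∸ 1) × x ≡ ℤ.+ rev k y

  RevLayer : ℕ → ℤ → Set
  RevLayer d x = ∃ λ y → (T + (2 ^ d) div2^ 1 ≤ y × y ≤ T + 2 ^ d ∸ 1) × x ≡ ℤ.+ rev k y

  RevLayersUpTo : ℕ → ℤ → Set
  RevLayersUpTo d x = ∃ λ j → j ≤ d × RevLayer j x

  RevOffsets : (ℕ → Set) → ℤ → Set
  RevOffsets P x = ∃ λ u → P u × x ≡ ℤ.+ rev k (T + u)

  q : ℕ
  q = T div2^ l

  T≡2^l*q : T ≡ 2 ^ l * q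
  T≡2^l*q = trans (m≡m%n+[m/n]*n T (2 ^ l) {{m^n≢0 2 l}})
                  (trans (cong (_+ q * 2 ^ l) 2^l∣T) (*-comm q (2 ^ l)))

  rev-T+≡revBits : ∀ u → u < 2 ^ l → rev k (T + u) ≡ revBits (k ∸ l) q + 2 ^ (k ∸ l) * revBits l u
  rev-T+≡revBits u u<2^l = begin
    rev k (T + u)                                   ≡⟨ rev≡revBits k (T + u) ⟩
    revBits k (T + u)                               ≡⟨ cong₂ revBits (m+[n∸m]≡n l≤k) T+u≡ ⟨
    revBits (l + (k ∸ l)) (u + 2 ^ l * q)           ≡⟨ revBits-split l (k ∸ l) u q u<2^l ⟩
    2 ^ (k ∸ l) * revBits l u + revBits (k ∸ l) q   ≡⟨ +-comm _ (revBits (k ∸ l) q) ⟩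
    revBits (k ∸ l) q + 2 ^ (k ∸ l) * revBits l u   ∎
    where
    open ≡-Reasoning
    T+u≡ : u + 2 ^ l * q ≡ T + u
    T+u≡ = trans (cong (u +_) (sym T≡2^l*q)) (+-comm u T)

  rev-T+ : ∀ u → u < 2 ^ l → rev k (T + u) ≡ r + 2 ^ (k ∸ l) * revBits l u
  rev-T+ u u<2^l = trans (rev-T+≡revBits u u<2^l) (cong (_+ 2 ^ (k ∸ l) * revBits l u) (sym r≡revBits))
    where
    r≡revBits : r ≡ revBits (k ∸ l) q
    r≡revBits = begin
      rev k T                       ≡⟨ cong (rev k) (+-identityʳ T) ⟨
      rev k (T + 0)                 ≡⟨ rev-T+≡revBits 0 (m^n>0 2 l) ⟩
      Q + 2 ^ (k ∸ l) * revBits l 0 ≡⟨ cong (λ a → Q + 2 ^ (k ∸ l) * a) (revBits-zero l) ⟩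
      Q + 2 ^ (k ∸ l) * 0           ≡⟨ cong (Q +_) (*-zeroʳ (2 ^ (k ∸ l))) ⟩
      Q + 0                         ≡⟨ +-identityʳ Q ⟩
      Q                             ∎
      where
      open ≡-Reasoning
      Q = revBits (k ∸ l) q

  r≤rev-T+ : ∀ u → u < 2 ^ l → r ≤ rev k (T + u)
  r≤rev-T+ u u<2^l = subst (r ≤_) (sym (rev-T+ u u<2^l)) (m≤m+n r _)

  rev-T+2^+ : ∀ d v → suc d ≤ l → v < 2 ^ d →
    rev k (T + (2 ^ d + v)) ≡ r + 2 ^ (k ∸ suc d) * suc (2 * revBits d v)
  rev-T+2^+ d v d<l v<2^d = begin
      rev k (T + (2 ^ d + v))
    ≡⟨ rev-T+ (2 ^ d + v) (<-≤-trans (proj₂ (inLayer-suc⇐ d v<2^d)) (^-monoʳ-≤ 2 d<l)) ⟩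
      r + 2 ^ (k ∸ l) * revBits l (2 ^ d + v)
    ≡⟨ cong (λ a → r + 2 ^ (k ∸ l) * a) (revBits-2^+ l d v d<l v<2^d) ⟩
      r + 2 ^ (k ∸ l) * (2 ^ (l ∸ suc d) * suc (2 * revBits d v))
    ≡⟨ cong (r +_) (*-assoc (2 ^ (k ∸ l)) _ _) ⟨
      r + 2 ^ (k ∸ l) * 2 ^ (l ∸ suc d) * suc (2 * revBits d v)
    ≡⟨ cong (λ a → r + a * suc (2 * revBits d v)) (2^[k∸l]*2^[l∸m]≡2^[k∸m] k l (suc d) d<l l≤k) ⟩
      r + 2 ^ (k ∸ suc d) * suc (2 * revBits d v) ∎
    where open ≡-Reasoning

  T+2^l≤2^k : T + 2 ^ l ≤ 2 ^ k
  T+2^l≤2^k = begin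
    T + 2 ^ l                  ≡⟨ cong (_+ 2 ^ l) T≡2^l*q ⟩
    2 ^ l * q + 2 ^ l          ≡⟨ +-comm _ (2 ^ l) ⟩
    2 ^ l + 2 ^ l * q          ≡⟨ *-suc (2 ^ l) q ⟨
    2 ^ l * suc q              ≤⟨ *-monoʳ-≤ (2 ^ l) q<2^[k∸l] ⟩
    2 ^ l * 2 ^ (k ∸ l)        ≡⟨ 2^k≡ ⟨
    2 ^ k                      ∎
    where
    open ≤-Reasoning
    2^k≡ : 2 ^ k ≡ 2 ^ l * 2 ^ (k ∸ l)
    2^k≡ = trans (cong (2 ^_) (sym (m+[n∸m]≡n l≤k))) (^-distribˡ-+-* 2 l (k ∸ l))
    q<2^[k∸l] : q < 2 ^ (k ∸ l)
    q<2^[k∸l] = *-cancelˡ-< (2 ^ l) q (2 ^ (k ∸ l)) (subst₂ _<_ T≡2^l*q 2^k≡ T<2^k)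

  rev-rev-T+ : ∀ u → u < 2 ^ l → rev k (rev k (T + u)) ≡ T + u
  rev-rev-T+ u u<2^l = rev-involutive k (T + u) (<-≤-trans (+-monoʳ-< T u<2^l) T+2^l≤2^k)

  revBlock≐offsets : RevBlock ≐ RevOffsets (_< 2 ^ l)
  revBlock≐offsets x = to , from
    where
    to : RevBlock x → RevOffsets (_< 2 ^ l) x
    to (y , (T≤y , y≤) , x≡)
      with interval⇒offset T (≤-trans (≤-reflexive (+-identityʳ T)) T≤y) y≤ (m^n>0 2 l)
    ... | u , (_ , u<2^l) , y≡T+u = u , u<2^l , trans x≡ (cong (λ a → ℤ.+ rev k a) y≡T+u)
    from : RevOffsets (_< 2 ^ l) x → RevBlock x
    from (u , u<2^l , x≡) = T + u , (m≤m+n T u , proj₂ (offset⇒interval T z≤n u<2^l)) , x≡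

  revLayer≐offsets : ∀ d → RevLayer d ≐ RevOffsets (InLayer d)
  revLayer≐offsets d x = to , from
    where
    to : RevLayer d x → RevOffsets (InLayer d) x
    to (y , (lo , hi) , x≡) with interval⇒offset T lo hi (m^n>0 2 d)
    ... | u , u∈d , y≡T+u = u , u∈d , trans x≡ (cong (λ a → ℤ.+ rev k a) y≡T+u)
    from : RevOffsets (InLayer d) x → RevLayer d x
    from (u , (lo , hi) , x≡) = T + u , offset⇒interval T lo hi , x≡

  revLayer-zero : RevLayer 0 ≐ ｛ ℤ.+ r ｝
  revLayer-zero x = to , from
    where
    to : RevLayer 0 x → x ≡ ℤ.+ r
    to x∈ with proj₁ (revLayer≐offsets 0 x) x∈
    ... | u , u∈0 , x≡ rewrite inLayer-zero u∈0 = trans x≡ (cong (λ a → ℤ.+ rev k a) (+-identityʳ T))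
    from : x ≡ ℤ.+ r → RevLayer 0 x
    from x≡r = proj₂ (revLayer≐offsets 0 x)
      (0 , (z≤n , s≤s z≤n) , trans x≡r (cong (λ a → ℤ.+ rev k a) (sym (+-identityʳ T))))

  revLayer-suc : ∀ d → suc d ≤ l → RevLayer (suc d) ≐ OddShift k (ℤ.+ r) d
  revLayer-suc d d<l = ≐-trans (revLayer≐offsets (suc d)) offsets≐OddShift
    where
    rev-T+2^+≡ : ∀ v → v < 2 ^ d →
      ℤ.+ rev k (T + (2 ^ d + v)) ≡ ℤ.+ r ℤ.+ ℤ.+ (2 ^ (k ∸ suc d) * suc (2 * revBits d v))
    rev-T+2^+≡ v v<2^d = trans (cong ℤ.+_ (rev-T+2^+ d v d<l v<2^d)) (ℤ.pos-+ r _)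
    offsets≐OddShift : RevOffsets (InLayer (suc d)) ≐ OddShift k (ℤ.+ r) d
    offsets≐OddShift x = to , from
      where
      to : RevOffsets (InLayer (suc d)) x → OddShift k (ℤ.+ r) d x
      to (u , u∈ , x≡) with inLayer-suc⇒ d u∈
      ... | v , v<2^d , refl = revBits d v , revBits-< d v , trans x≡ (rev-T+2^+≡ v v<2^d)
      from : OddShift k (ℤ.+ r) d x → RevOffsets (InLayer (suc d)) x
      from (B , B<2^d , x≡) = 2 ^ d + v , inLayer-suc⇐ d (revBits-< d B) , (begin
          x                                             ≡⟨ x≡ ⟩
          ℤ.+ r ℤ.+ ℤ.+ (P * suc (2 * B))               ≡⟨ cong (λ b → ℤ.+ r ℤ.+ ℤ.+ (P * suc (2 * b)))
                                                              (revBits-involutive d B B<2^d) ⟨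
          ℤ.+ r ℤ.+ ℤ.+ (P * suc (2 * revBits d v))     ≡⟨ rev-T+2^+≡ v (revBits-< d B) ⟨
          ℤ.+ rev k (T + (2 ^ d + v))                   ∎)
        where
        open ≡-Reasoning
        v = revBits d B
        P = 2 ^ (k ∸ suc d)

  revLayer≐L : ∀ d → 1 ≤ d → d ≤ l → RevLayer d ≐ L (k ∸ 1) (d ∸ 1) z
  revLayer≐L (suc d) _ d<l = ≐-trans (revLayer-suc d d<l) (OddShift≐L k (ℤ.+ r) d (≤-trans d<l l≤k))

  revLayersUpTo≐ : ∀ d → 1 ≤ d → d ≤ l → RevLayersUpTo d ≐ (｛ ℤ.+ r ｝ ∪ ST (k ∸ 1) (d ∸ 1) z)
  revLayersUpTo≐ (suc d) _ d<l x = to , from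
    where
    layer≐L : ∀ {j} → j ≤ d → RevLayer (suc j) ≐ L (k ∸ 1) j z
    layer≐L j≤d = revLayer≐L _ (s≤s z≤n) (≤-trans (s≤s j≤d) d<l)
    to : RevLayersUpTo (suc d) x → (｛ ℤ.+ r ｝ ∪ ST (k ∸ 1) d z) x
    to (zero  , _       , x∈) = inj₁ (proj₁ (revLayer-zero x) x∈)
    to (suc j , s≤s j≤d , x∈) = inj₂ (j , j≤d , proj₁ (layer≐L j≤d x) x∈)
    from : (｛ ℤ.+ r ｝ ∪ ST (k ∸ 1) d z) x → RevLayersUpTo (suc d) x
    from (inj₁ x≡r)            = 0 , z≤n , proj₂ (revLayer-zero x) x≡r
    from (inj₂ (j , j≤d , x∈)) = suc j , s≤s j≤d , proj₂ (layer≐L j≤d x) x∈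

  revLayersUpTo-zero : RevLayersUpTo 0 ≐ ｛ ℤ.+ r ｝
  revLayersUpTo-zero x = (λ { (zero , z≤n , x∈) → proj₁ (revLayer-zero x) x∈ }) ,
                         (λ x≡r → 0 , z≤n , proj₂ (revLayer-zero x) x≡r)

  revBlock≐revLayersUpTo : RevBlock ≐ RevLayersUpTo l
  revBlock≐revLayersUpTo x = to , from
    where
    to : RevBlock x → RevLayersUpTo l x
    to x∈ with proj₁ (revBlock≐offsets x) x∈
    ... | u , u<2^l , x≡ with layerOf l u u<2^l
    ... | d , d≤l , u∈d = d , d≤l , proj₂ (revLayer≐offsets d x) (u , u∈d , x≡)
    from : RevLayersUpTo l x → RevBlock x
    from (d , d≤l , x∈) with proj₁ (revLayer≐offsets d x) x∈
    ... | u , (_ , u<2^d) , x≡ = proj₂ (revBlock≐offsets x) (u , <-≤-trans u<2^d (^-monoʳ-≤ 2 d≤l) , x≡)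

  revBlock≐ : 0 < l → RevBlock ≐ (｛ ℤ.+ r ｝ ∪ ST (k ∸ 1) (l ∸ 1) z)
  revBlock≐ 0<l = ≐-trans revBlock≐revLayersUpTo (revLayersUpTo≐ l 0<l ≤-refl)

  revBlock≐｛r｝ : l ≡ 0 → RevBlock ≐ ｛ ℤ.+ r ｝
  revBlock≐｛r｝ l≡0 =
    ≐-trans (subst (λ m → RevBlock ≐ RevLayersUpTo m) l≡0 revBlock≐revLayersUpTo) revLayersUpTo-zero

  revBlock∩dsc⇒revLayer : ∀ {n} (c : Vec Sign n) {x} → n ≤ l →
    RevBlock x → x ≡ dsc k (ℤ.+ r) c → RevLayer n x
  revBlock∩dsc⇒revLayer []           {x} _   _  x≡ = proj₂ (revLayer-zero x) (trans x≡ (ℤ.+-identityʳ _))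
  revBlock∩dsc⇒revLayer (Sign.+ ∷ c) {x} n<l _  x≡ =
    proj₂ (revLayer≐L _ (s≤s z≤n) n<l x) (c , trans x≡ (dsc-∷ k (ℤ.+ r) Sign.+ c))
  revBlock∩dsc⇒revLayer (Sign.- ∷ c) {x} n<l x∈ x≡ with proj₁ (revBlock≐offsets x) x∈
  ... | u , u<2^l , x≡rev = ⊥-elim (<⇒≱ rev<r (r≤rev-T+ u u<2^l))
    where
    rev<r : rev k (T + u) < r
    rev<r = dsc-−∷-< k r (rev k (T + u)) c (≤-trans n<l l≤k) (trans (sym x≡) x≡rev)

  rev∣revLayer∣ : ∀ {d x} → d ≤ l → RevLayer d x → ∃ λ u → InLayer d u × rev k ℤ.∣ x ∣ ≡ T + u
  rev∣revLayer∣ {d} {x} d≤l x∈ with proj₁ (revLayer≐offsets d x) x∈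
  ... | u , u∈d , x≡ = u , u∈d ,
    trans (cong (λ a → rev k ℤ.∣ a ∣) x≡) (rev-rev-T+ u (<-≤-trans (proj₂ u∈d) (^-monoʳ-≤ 2 d≤l)))

  rev∣dsc∣-< : ∀ d' d'' → d' < d'' → d'' ≤ l →
    (c' : Vec Sign d') (c'' : Vec Sign d'') (x' x'' : ℤ) →
    x' ≡ dsc k (ℤ.+ r) c' → x'' ≡ dsc k (ℤ.+ r) c'' →
    RevBlock x' → RevBlock x'' → rev k ℤ.∣ x' ∣ < rev k ℤ.∣ x'' ∣
  rev∣dsc∣-< d' d'' d'<d'' d''≤l c' c'' x' x'' x'≡ x''≡ x'∈ x''∈ =
    let u'  , u'∈  , rev∣x'∣≡  = rev∣revLayer∣ d'≤l (revBlock∩dsc⇒revLayer c' d'≤l x'∈ x'≡)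
        u'' , u''∈ , rev∣x''∣≡ = rev∣revLayer∣ d''≤l (revBlock∩dsc⇒revLayer c'' d''≤l x''∈ x''≡)
    in subst₂ _<_ (sym rev∣x'∣≡) (sym rev∣x''∣≡) (+-monoʳ-< T (inLayer-< d'<d'' u'∈ u''∈))
    where
    d'≤l = ≤-trans (<⇒≤ d'<d'') d''≤l

maxL≤ : ∀ m x → maxL m x ≤ m
maxL≤ zero    x = z≤n
maxL≤ (suc m) x with x mod2^ suc m ≟ 0
... | yes _ = ≤-refl
... | no  _ = m≤n⇒m≤1+n (maxL≤ m x)

2^maxL∣ : ∀ m x → x mod2^ maxL m x ≡ 0
2^maxL∣ zero    x = n%1≡0 x
2^maxL∣ (suc m) x with x mod2^ suc m ≟ 0
... | yes 2^m∣x = 2^m∣x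
... | no  _     = 2^maxL∣ m x

t<2^k : ∀ k s i → s < 2 ^ k → t k s i < 2 ^ k
t<2^k k s zero    s<2^k = s<2^k
t<2^k k s (suc i) _     = m%n<n _ (2 ^ k) {{m^n≢0 2 k}}

-- Only 2^(l_{k,s,i}) ∣ t_{k,s,i} < 2^k is used.
lemma11 : (k s i : ℕ) → s < 2 ^ k → (m : ℕ) → IsLast k s m → i ≤ m →
    (Xj k s i 0 ≐ ｛ ℤ.+ rev k (t k s i) ｝
      × (∀ d → 1 ≤ d → d ≤ lv k s i →
           XjUpTo k s i d ≐
             (｛ ℤ.+ rev k (t k s i) ｝ ∪ ST (k ∸ 1) (d ∸ 1) (dsc k (ℤ.+ rev k (t k s i)) (Sign.+ ∷ [])))))
    × ((0 < lv k s i →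
          X k s i ≐ (｛ ℤ.+ rev k (t k s i) ｝ ∪ ST (k ∸ 1) (lv k s i ∸ 1) (dsc k (ℤ.+ rev k (t k s i)) (Sign.+ ∷ []))))
      × (lv k s i ≡ 0 → X k s i ≐ ｛ ℤ.+ rev k (t k s i) ｝))
    × (∀ d → 1 ≤ d → d ≤ lv k s i →
         Xj k s i d ≐ L (k ∸ 1) (d ∸ 1) (dsc k (ℤ.+ rev k (t k s i)) (Sign.+ ∷ [])))
    × (∀ d' d'' → d' < d'' → d'' ≤ lv k s i →
         (c' : Vec Sign d') (c'' : Vec Sign d'') (x' x'' : ℤ) →
         x' ≡ dsc k (ℤ.+ rev k (t k s i)) c' → x'' ≡ dsc k (ℤ.+ rev k (t k s i)) c'' →
         X k s i x' → X k s i x'' → rev k ℤ.∣ x' ∣ < rev k ℤ.∣ x'' ∣)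
lemma11 k s i s<2^k _ _ _ =
  (revLayer-zero , revLayersUpTo≐) , (revBlock≐ , revBlock≐｛r｝) , revLayer≐L , rev∣dsc∣-<
  where
  open AlignedBlock k (t k s i) (lv k s i) (maxL≤ k (t k s i)) (2^maxL∣ k (t k s i)) (t<2^k k s i s<2^k)
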